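{- Let $f(n)=an^{2}+bn+c$ with $a,b,c\in\mathbb{Z}$, $a$ odd and $b$ even, and suppose $b^{2}-4ac=4^{\ell}\Delta$ where $\ell$ is the largest positive integer with $4^{\ell}\mid b^2-4ac$ and $\Delta\equiv m\pmod 8$ with $m\in\{2,3,5,6,7\}$. Then the 2-adic valuation tree of $f$ is finite with $\ell$ levels.
   Context: $\nu_2(x)$ denotes the 2-adic valuation of an integer $x$ (with $\nu_2(0)=+\infty$), $\mathbb{N}=\{0,1,2,\ldots\}$. The 2-adic valuation tree of $f$: a node at level $i\geq 0$ is a residue class $\{2^{i}q+r: q\in\mathbb{N}\}$ with $0\le r<2^i$; a node is terminating if $\nu_2(f(n))$ is constant on its class, and non-terminating nodes split into the two classes $\{2^{i+1}q+r\}$, $\{2^{i+1}q+2^i+r\}$ at level $i+1$. The tree is finite with $\ell$ levels if $\ell$ is the smallest positive integer such that for every $r\in\{0,1,\ldots,2^{\ell}-1\}$ the sequence $(\nu_2(f(2^{\ell}q+r)))_{q\ge 0}$ is constant. -}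

module Defs where

open import Data.Nat as ℕ using (ℕ; zero; suc; _≤_; _<_)
open import Data.Nat.Divisibility as ℕD using ()
open import Data.Integer as ℤ using (ℤ; +_)
open import Data.Maybe using (Maybe; just; nothing)
open import Data.Product using (_×_)
open import Relation.Binary.PropositionalEquality using (_≡_)
open import Relation.Nullary using (¬_; yes; no)

-- 2-adic valuation of a positive natural, computed with fuel (fuel = n suffices).
ν₂ℕ-fuel : ℕ → ℕ → ℕ
ν₂ℕ-fuel zero n = 0
ν₂ℕ-fuel (suc k) zero = 0
ν₂ℕ-fuel (suc k) (suc n) with 2 ℕD.∣? suc n
... | yes _ = suc (ν₂ℕ-fuel k (ℕ._/_ (suc n) 2))
... | no _ = 0

-- ν₂ : ℤ → ℕ ∪ {+∞}, with nothing representing +∞ (i.e. ν₂(0) = +∞).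
ν₂ : ℤ → Maybe ℕ
ν₂ x with ℤ.∣ x ∣
... | zero = nothing
... | suc n = just (ν₂ℕ-fuel (suc n) (suc n))

quad : ℤ → ℤ → ℤ → ℕ → ℤ
quad a b c n = a ℤ.* (+ n) ℤ.* (+ n) ℤ.+ b ℤ.* (+ n) ℤ.+ c

AllClassesTerminate : (ℕ → ℤ) → ℕ → Set
AllClassesTerminate f k =
  ∀ r → r < 2 ℕ.^ k → ∀ q → ν₂ (f (2 ℕ.^ k ℕ.* q ℕ.+ r)) ≡ ν₂ (f r)

FiniteTreeWithLevels : (ℕ → ℤ) → ℕ → Set
FiniteTreeWithLevels f ℓ =
  1 ≤ ℓ × AllClassesTerminate f ℓ × (∀ k → 1 ≤ k → k < ℓ → ¬ AllClassesTerminate f k)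

-- Write ℓ = L + 1, a = 2α + 1 and b = 2β.  Completing the square gives
-- a f(n) = X(n)² − 4^L Δ with X(n) = a n + β, and as a is odd, ν₂(f(n)) is the
-- valuation of X(n)² − 4^L Δ.  If 2^j exactly divides X(n) with j < L this is 2j;
-- otherwise X(n) = 2^L Y and it is 2L + ν₂(Y² − Δ).  Because Δ mod 8 lies in
-- {2,3,5,6,7}, ν₂(Y² − Δ) is determined by the parity of Y, with different values
-- for odd and even Y.  So ν₂(f(n)) only depends on X(n) mod 2^ℓ, hence on n mod 2^ℓ.
-- Conversely, for 1 ≤ k ≤ L, on a class n ≡ r (mod 2^k) with 2^k ∣ X(r) the
-- values X(n) = X(r) + 2^k a q meet every residue mod 2^ℓ of a multiple of 2^k (a is
-- odd), in particular an odd multiple of 2^k and a multiple of 2^ℓ, and these give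
-- different valuations.
module Submission where

open import Defs
open import Data.Nat as ℕ using (ℕ; zero; suc; _≤_; _<_; _∸_; z≤n; s≤s)
import Data.Nat.Properties as ℕₚ
import Data.Nat.Divisibility as ℕ∣
open import Data.Nat.DivMod using (m≡m%n+[m/n]*n; m%n<n; m*n/n≡m)
open import Data.Integer as ℤ using (ℤ; +_; -[1+_]; _+_; _*_; _-_; -_; ∣_∣; _%ℕ_; _/ℕ_)
import Data.Integer.Properties as ℤₚ
open import Data.Integer.DivMod using (a≡a%ℕn+[a/ℕn]*n; n%ℕd<d)
open import Data.Integer.Divisibility using (_∣_)
import Data.Integer.Divisibility.Signed as ℤ∣
open import Data.Integer.Tactic.RingSolver using (solve-∀; solve)
open import Data.List using (_∷_; [])
open import Data.List.Membership.Propositional using (_∈_)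
open import Data.List.Relation.Unary.Any using (here; there)
open import Data.Maybe using (just)
open import Data.Maybe.Properties using (just-injective)
open import Data.Product using (∃-syntax; _,_; _×_)
open import Data.Sum using (_⊎_; inj₁; inj₂)
open import Relation.Binary.PropositionalEquality
open import Relation.Nullary using (¬_; yes; no; contradiction)
open ≡-Reasoning

2^_ : ℕ → ℤ
2^ v = + (2 ℕ.^ v)

2^-suc-*ˡ : ∀ v z → 2^ suc v * z ≡ + 2 * (2^ v * z)
2^-suc-*ˡ v z = trans (cong (_* z) (ℤₚ.pos-* 2 (2 ℕ.^ v))) (ℤₚ.*-assoc (+ 2) (2^ v) z)

2^-suc-*ʳ : ∀ v z → 2^ suc v * z ≡ 2^ v * (+ 2 * z)
2^-suc-*ʳ v z = begin
  2^ suc v * z      ≡⟨ 2^-suc-*ˡ v z ⟩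
  + 2 * (2^ v * z)  ≡⟨ ℤₚ.*-assoc (+ 2) (2^ v) z ⟨
  + 2 * 2^ v * z    ≡⟨ cong (_* z) (ℤₚ.*-comm (+ 2) (2^ v)) ⟩
  2^ v * + 2 * z    ≡⟨ ℤₚ.*-assoc (2^ v) (+ 2) z ⟩
  2^ v * (+ 2 * z)  ∎

2^-+ : ∀ i j → 2^ (i ℕ.+ j) ≡ 2^ i * 2^ j
2^-+ i j = trans (cong +_ (ℕₚ.^-distribˡ-+-* 2 i j)) (ℤₚ.pos-* (2 ℕ.^ i) (2 ℕ.^ j))

4^≡2^*2^ : ∀ v → + (4 ℕ.^ v) ≡ 2^ v * 2^ v
4^≡2^*2^ v = trans (cong +_ 4^≡) (2^-+ v v)
  where
  4^≡ : 4 ℕ.^ v ≡ 2 ℕ.^ (v ℕ.+ v)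
  4^≡ = trans (ℕₚ.^-*-assoc 2 2 v) (cong (λ e → 2 ℕ.^ (v ℕ.+ e)) (ℕₚ.+-identityʳ v))

odd : ℤ → ℤ
odd w = + 2 * w + + 1

parity : ∀ x → ∃[ u ] (x ≡ + 2 * u ⊎ x ≡ odd u)
parity x with x %ℕ 2 | a≡a%ℕn+[a/ℕn]*n x 2 | n%ℕd<d x 2
... | 0 | x≡ | _ = x /ℕ 2 , inj₁ (trans x≡ (regroup (x /ℕ 2)))
  where
  regroup : ∀ q → + 0 + q * + 2 ≡ + 2 * q
  regroup = solve-∀
... | 1 | x≡ | _ = x /ℕ 2 , inj₂ (trans x≡ (regroup (x /ℕ 2)))
  where
  regroup : ∀ q → + 1 + q * + 2 ≡ + 2 * q + + 1
  regroup = solve-∀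
... | suc (suc _) | _ | s≤s (s≤s ())

even≢odd : ∀ x y → + 2 * x ≢ odd y
even≢odd x y 2x≡2y+1 = ℕₚ.even≢odd ∣ x - y ∣ 0 (begin
  2 ℕ.* ∣ x - y ∣    ≡⟨ ℤₚ.abs-* (+ 2) (x - y) ⟨
  ∣ + 2 * (x - y) ∣  ≡⟨ cong ∣_∣ 2[x-y]≡1 ⟩
  1                  ∎)
  where
  2[x-y]≡1 : + 2 * (x - y) ≡ + 1
  2[x-y]≡1 = begin
    + 2 * (x - y)            ≡⟨ solve (x ∷ y ∷ []) ⟩
    + 2 * x - + 2 * y        ≡⟨ cong (_- + 2 * y) 2x≡2y+1 ⟩
    + 2 * y + + 1 - + 2 * y  ≡⟨ solve (y ∷ []) ⟩
    + 1                      ∎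

infix 4 2^_∥_
2^_∥_ : ℕ → ℤ → Set
2^ v ∥ x = ∃[ w ] x ≡ 2^ v * odd w

odd-∥ : ∀ u → 2^ 0 ∥ odd u
odd-∥ u = u , sym (ℤₚ.*-identityˡ (odd u))

even-∦ : ∀ u → ¬ 2^ 0 ∥ + 2 * u
even-∦ u (w , e) = even≢odd u w (trans e (ℤₚ.*-identityˡ (odd w)))

odd-∦ : ∀ v u → ¬ 2^ suc v ∥ odd u
odd-∦ v u (w , e) = even≢odd (2^ v * odd w) u (sym (trans e (2^-suc-*ˡ v (odd w))))

∥-double : ∀ v {x} → 2^ v ∥ x → 2^ suc v ∥ + 2 * x
∥-double v {x} (w , x≡) = w , trans (cong (+ 2 *_) x≡) (sym (2^-suc-*ˡ v (odd w)))

∥-halve : ∀ v {x} → 2^ suc v ∥ + 2 * x → 2^ v ∥ x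
∥-halve v {x} (w , 2x≡) = w , ℤₚ.*-cancelˡ-≡ (+ 2) x (2^ v * odd w) (trans 2x≡ (2^-suc-*ˡ v (odd w)))

odd*even : ∀ α u → odd α * (+ 2 * u) ≡ + 2 * (odd α * u)
odd*even α u = regroup α u
  where
  regroup : ∀ α u → (+ 2 * α + + 1) * (+ 2 * u) ≡ + 2 * ((+ 2 * α + + 1) * u)
  regroup = solve-∀

odd*odd : ∀ α u → odd α * odd u ≡ odd (α + u + + 2 * α * u)
odd*odd α u = regroup α u
  where
  regroup : ∀ α u → (+ 2 * α + + 1) * (+ 2 * u + + 1) ≡ + 2 * (α + u + + 2 * α * u) + + 1
  regroup = solve-∀

∥-cancel-odd : ∀ α v x → 2^ v ∥ odd α * x → 2^ v ∥ x
∥-cancel-odd α zero x h with parity x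
... | u , inj₁ refl = contradiction (subst (2^ 0 ∥_) (odd*even α u) h) (even-∦ (odd α * u))
... | u , inj₂ refl = odd-∥ u
∥-cancel-odd α (suc v) x h with parity x
... | u , inj₁ refl =
  ∥-double v (∥-cancel-odd α v u (∥-halve v (subst (2^ suc v ∥_) (odd*even α u) h)))
... | u , inj₂ refl = contradiction (subst (2^ suc v ∥_) (odd*odd α u) h) (odd-∦ v (α + u + + 2 * α * u))

2^-<-factor : ∀ {j k} → j < k → ∃[ d ] 2^ k ≡ 2^ j * (+ 2 * 2^ d)
2^-<-factor {j} j<k with ℕₚ.m≤n⇒∃[o]m+o≡n j<k
... | d , refl = d , (begin
  2^ (suc j ℕ.+ d)   ≡⟨ 2^-+ (suc j) d ⟩
  2^ suc j * 2^ d    ≡⟨ 2^-suc-*ʳ j (2^ d) ⟩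
  2^ j * (+ 2 * 2^ d) ∎)

∥-+-multiple : ∀ {j k x} t → j < k → 2^ j ∥ x → 2^ j ∥ x + 2^ k * t
∥-+-multiple {j} {k} {x} t j<k (w , x≡) with 2^-<-factor j<k
... | d , 2^k≡ = w + 2^ d * t , (begin
  x + 2^ k * t                              ≡⟨ cong₂ (λ x p → x + p * t) x≡ 2^k≡ ⟩
  2^ j * odd w + 2^ j * (+ 2 * 2^ d) * t    ≡⟨ regroup (2^ j) (2^ d) w t ⟩
  2^ j * odd (w + 2^ d * t)                 ∎)
  where
  regroup : ∀ p q w t → p * (+ 2 * w + + 1) + p * (+ 2 * q) * t ≡ p * (+ 2 * (w + q * t) + + 1)
  regroup = solve-∀

2^-split : ∀ k x → (∃[ z ] x ≡ 2^ k * z) ⊎ (∃[ j ] j < k × 2^ j ∥ x)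
2^-split zero x = inj₁ (x , sym (ℤₚ.*-identityˡ x))
2^-split (suc k) x with parity x
... | u , inj₂ refl = inj₂ (0 , s≤s z≤n , odd-∥ u)
... | u , inj₁ refl with 2^-split k u
...   | inj₁ (z , u≡) = inj₁ (z , trans (cong (+ 2 *_) u≡) (sym (2^-suc-*ˡ k z)))
...   | inj₂ (j , j<k , j∥u) = inj₂ (suc j , s≤s j<k , ∥-double j j∥u)

odd-slope-hits-odd : ∀ α t → ∃[ q ] ∃[ u ] odd α * + q + t ≡ odd u
odd-slope-hits-odd α t with parity t
... | u , inj₁ refl = 1 , α + u , regroup α u
  where
  regroup : ∀ α u → (+ 2 * α + + 1) * + 1 + + 2 * u ≡ + 2 * (α + u) + + 1
  regroup = solve-∀
... | u , inj₂ refl = 0 , u , regroup α u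
  where
  regroup : ∀ α u → (+ 2 * α + + 1) * + 0 + (+ 2 * u + + 1) ≡ + 2 * u + + 1
  regroup = solve-∀

odd-slope-hits-multiple : ∀ α m t → ∃[ q ] ∃[ z ] odd α * + q + t ≡ 2^ m * z
odd-slope-hits-multiple α zero t = 0 , t , regroup α t
  where
  regroup : ∀ α t → (+ 2 * α + + 1) * + 0 + t ≡ + 1 * t
  regroup = solve-∀
odd-slope-hits-multiple α (suc m) t with odd-slope-hits-multiple α m t
... | q , z , e with parity z
...   | u , inj₁ refl = q , u , trans e (sym (2^-suc-*ʳ m u))
...   | u , inj₂ refl = q ℕ.+ 2 ℕ.^ m , u + α + + 1 , (begin
  odd α * + (q ℕ.+ 2 ℕ.^ m) + t       ≡⟨ cong (λ n → odd α * n + t) (ℤₚ.pos-+ q (2 ℕ.^ m)) ⟩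
  odd α * (+ q + 2^ m) + t            ≡⟨ regroup (odd α) (+ q) (2^ m) t ⟩
  odd α * + q + t + 2^ m * odd α      ≡⟨ cong (_+ 2^ m * odd α) e ⟩
  2^ m * odd u + 2^ m * odd α         ≡⟨ ℤₚ.*-distribˡ-+ (2^ m) (odd u) (odd α) ⟨
  2^ m * (odd u + odd α)              ≡⟨ cong (2^ m *_) (odd+odd u α) ⟩
  2^ m * (+ 2 * (u + α + + 1))        ≡⟨ 2^-suc-*ʳ m (u + α + + 1) ⟨
  2^ suc m * (u + α + + 1)            ∎)
  where
  regroup : ∀ a q p t → a * (q + p) + t ≡ a * q + t + p * a
  regroup = solve-∀
  odd+odd : ∀ u α → (+ 2 * u + + 1) + (+ 2 * α + + 1) ≡ + 2 * (u + α + + 1)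
  odd+odd = solve-∀

¬2∣odd : ∀ w → ¬ 2 ℕ∣.∣ suc (2 ℕ.* w)
¬2∣odd w (ℕ∣.divides q e) = ℕₚ.even≢odd q w (sym (trans e (ℕₚ.*-comm q 2)))

2^*odd≢0 : ∀ v w → 2 ℕ.^ v ℕ.* suc (2 ℕ.* w) ≢ 0
2^*odd≢0 v w = ℕ.≢-nonZero⁻¹ _ {{ℕₚ.m*n≢0 (2 ℕ.^ v) _ {{ℕₚ.m^n≢0 2 v}}}}

n<2^n : ∀ n → n < 2 ℕ.^ n
n<2^n zero = s≤s z≤n
n<2^n (suc n) = ℕₚ.+-mono-≤-< (ℕₚ.m^n>0 2 n) (subst (n <_) (sym (ℕₚ.+-identityʳ _)) (n<2^n n))

2^[1+v]*n≡2^v*n*2 : ∀ v n → 2 ℕ.^ suc v ℕ.* n ≡ 2 ℕ.^ v ℕ.* n ℕ.* 2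
2^[1+v]*n≡2^v*n*2 v n = trans (ℕₚ.*-assoc 2 (2 ℕ.^ v) n) (ℕₚ.*-comm 2 (2 ℕ.^ v ℕ.* n))

ν₂ℕ-fuel-exact : ∀ {k m} v w → m ≡ 2 ℕ.^ v ℕ.* suc (2 ℕ.* w) → v < k → ν₂ℕ-fuel k m ≡ v
ν₂ℕ-fuel-exact {suc k} {zero} v w m≡ _ = contradiction (sym m≡) (2^*odd≢0 v w)
ν₂ℕ-fuel-exact {suc k} {suc n} zero w m≡ _ with 2 ℕ∣.∣? suc n
... | yes 2∣m = contradiction (subst (2 ℕ∣.∣_) (trans m≡ (ℕₚ.*-identityˡ _)) 2∣m) (¬2∣odd w)
... | no _ = refl
ν₂ℕ-fuel-exact {suc k} {suc n} (suc v) w m≡ (s≤s v<k)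
  with 2 ℕ∣.∣? suc n | trans m≡ (2^[1+v]*n≡2^v*n*2 v (suc (2 ℕ.* w)))
... | yes _   | m≡o*2 = cong suc (ν₂ℕ-fuel-exact v w (trans (cong (ℕ._/ 2) m≡o*2) (m*n/n≡m _ 2)) v<k)
... | no 2∤m  | m≡o*2 = contradiction (ℕ∣.divides (2 ℕ.^ v ℕ.* suc (2 ℕ.* w)) m≡o*2) 2∤m

∣odd+∣ : ∀ n → ∣ odd (+ n) ∣ ≡ suc (2 ℕ.* n)
∣odd+∣ n = trans (cong (λ x → ∣ x + + 1 ∣) (sym (ℤₚ.pos-* 2 n))) (ℕₚ.+-comm (2 ℕ.* n) 1)

∣odd∣ : ∀ w → ∃[ n ] ∣ odd w ∣ ≡ suc (2 ℕ.* n)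
∣odd∣ (+ n) = n , ∣odd+∣ n
∣odd∣ -[1+ n ] = n , (begin
  ∣ odd -[1+ n ] ∣    ≡⟨ cong ∣_∣ (odd-neg (+ n)) ⟩
  ∣ - odd (+ n) ∣     ≡⟨ ℤₚ.∣-i∣≡∣i∣ (odd (+ n)) ⟩
  ∣ odd (+ n) ∣       ≡⟨ ∣odd+∣ n ⟩
  suc (2 ℕ.* n)       ∎)
  where
  odd-neg : ∀ x → + 2 * (- (+ 1 + x)) + + 1 ≡ - (+ 2 * x + + 1)
  odd-neg = solve-∀

ν₂-exact : ∀ {v x} → 2^ v ∥ x → ν₂ x ≡ just v
ν₂-exact {v} {x} (w , x≡) with ∣odd∣ w
... | n , ∣odd∣≡ = ν₂-from-abs (begin
  ∣ x ∣                      ≡⟨ cong ∣_∣ x≡ ⟩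
  ∣ 2^ v * odd w ∣           ≡⟨ ℤₚ.abs-* (2^ v) (odd w) ⟩
  2 ℕ.^ v ℕ.* ∣ odd w ∣       ≡⟨ cong (2 ℕ.^ v ℕ.*_) ∣odd∣≡ ⟩
  2 ℕ.^ v ℕ.* suc (2 ℕ.* n)   ∎)
  where
  ν₂-from-abs : ∣ x ∣ ≡ 2 ℕ.^ v ℕ.* suc (2 ℕ.* n) → ν₂ x ≡ just v
  ν₂-from-abs e with ∣ x ∣
  ... | zero = contradiction (sym e) (2^*odd≢0 v n)
  ... | suc m = cong just (ν₂ℕ-fuel-exact v n e v<1+m)
    where
    v<1+m : v < suc m
    v<1+m = ℕₚ.<-≤-trans (n<2^n v) (subst (2 ℕ.^ v ≤_) (sym e) (ℕₚ.m≤m*n (2 ℕ.^ v) (suc (2 ℕ.* n))))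

odd-square : ∀ y → ∃[ T ] odd y * odd y ≡ + 1 + + 8 * T
odd-square y with parity y
... | t , inj₁ refl = + 2 * t * t + t , regroup t
  where
  regroup : ∀ t → (+ 2 * (+ 2 * t) + + 1) * (+ 2 * (+ 2 * t) + + 1) ≡ + 1 + + 8 * (+ 2 * t * t + t)
  regroup = solve-∀
... | t , inj₂ refl = + 2 * t * t + + 3 * t + + 1 , regroup t
  where
  regroup : ∀ t → (+ 2 * (+ 2 * t + + 1) + + 1) * (+ 2 * (+ 2 * t + + 1) + + 1) ≡ + 1 + + 8 * (+ 2 * t * t + + 3 * t + + 1)
  regroup = solve-∀

record SquareGap (Δ : ℤ) : Set where
  field
    νodd νeven : ℕ
    odd²-Δ     : ∀ y → 2^ νodd ∥ odd y * odd y - Δ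
    even²-Δ    : ∀ z → 2^ νeven ∥ + 2 * z * (+ 2 * z) - Δ
    νodd≢νeven : νodd ≢ νeven

-- Odd squares are 1 mod 8 and even squares 0 mod 4, so y² − Δ has the valuation
-- of 1 − m or of −m, provided these are not divisible by 8 or 4 respectively.
squareGap-mod8 : ∀ {m} K νo νe → 2^ νo ∥ + 1 - + m → 2^ νe ∥ - + m →
                 νo < 3 → νe < 2 → νo ≢ νe → SquareGap (+ m + K * + 8)
squareGap-mod8 {m} K νo νe νo∥1-m νe∥-m νo<3 νe<2 νo≢νe = record
  { νodd = νo
  ; νeven = νe
  ; odd²-Δ = odd²-Δ
  ; even²-Δ = λ z → subst (2^ νe ∥_) (sym (regroup-even z K (+ m))) (∥-+-multiple (z * z - + 2 * K) νe<2 νe∥-m)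
  ; νodd≢νeven = νo≢νe
  }
  where
  regroup-odd : ∀ T K M → + 1 + + 8 * T - (M + K * + 8) ≡ + 1 - M + + 8 * (T - K)
  regroup-odd = solve-∀
  regroup-even : ∀ z K M → + 2 * z * (+ 2 * z) - (M + K * + 8) ≡ - M + + 4 * (z * z - + 2 * K)
  regroup-even = solve-∀
  odd²-Δ : ∀ y → 2^ νo ∥ odd y * odd y - (+ m + K * + 8)
  odd²-Δ y with odd-square y
  ... | T , y²≡ = subst (2^ νo ∥_) (sym (trans (cong (_- (+ m + K * + 8)) y²≡) (regroup-odd T K (+ m))))
                        (∥-+-multiple (T - K) νo<3 νo∥1-m)

squareGap : ∀ {Δ} → Δ %ℕ 8 ∈ (2 ∷ 3 ∷ 5 ∷ 6 ∷ 7 ∷ []) → SquareGap Δ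
squareGap {Δ} Δ%8∈ = subst SquareGap (sym (a≡a%ℕn+[a/ℕn]*n Δ 8)) (table Δ%8∈)
  where
  table : ∀ {m} → m ∈ (2 ∷ 3 ∷ 5 ∷ 6 ∷ 7 ∷ []) → SquareGap (+ m + Δ /ℕ 8 * + 8)
  table (here refl) =
    squareGap-mod8 (Δ /ℕ 8) 0 1 (-[1+ 0 ] , refl) (-[1+ 0 ] , refl) (s≤s z≤n) (s≤s (s≤s z≤n)) (λ ())
  table (there (here refl)) =
    squareGap-mod8 (Δ /ℕ 8) 1 0 (-[1+ 0 ] , refl) (-[1+ 1 ] , refl) (s≤s (s≤s z≤n)) (s≤s z≤n) (λ ())
  table (there (there (here refl))) =
    squareGap-mod8 (Δ /ℕ 8) 2 0 (-[1+ 0 ] , refl) (-[1+ 2 ] , refl) (s≤s (s≤s (s≤s z≤n))) (s≤s z≤n) (λ ())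
  table (there (there (there (here refl)))) =
    squareGap-mod8 (Δ /ℕ 8) 0 1 (-[1+ 2 ] , refl) (-[1+ 1 ] , refl) (s≤s z≤n) (s≤s (s≤s z≤n)) (λ ())
  table (there (there (there (there (here refl))))) =
    squareGap-mod8 (Δ /ℕ 8) 1 0 (-[1+ 1 ] , refl) (-[1+ 3 ] , refl) (s≤s (s≤s z≤n)) (s≤s z≤n) (λ ())

sq-sub-∥-below : ∀ {j L Y} Δ → j < L → 2^ j ∥ Y → 2^ (j ℕ.+ j) ∥ Y * Y - 2^ L * 2^ L * Δ
sq-sub-∥-below {j} {L} {Y} Δ j<L (y , Y≡) with 2^-<-factor j<L
... | d , 2^L≡ = w , (begin
  Y * Y - 2^ L * 2^ L * Δ
    ≡⟨ cong₂ (λ Y P → Y * Y - P * P * Δ) Y≡ 2^L≡ ⟩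
  2^ j * odd y * (2^ j * odd y) - 2^ j * (+ 2 * 2^ d) * (2^ j * (+ 2 * 2^ d)) * Δ
    ≡⟨ regroup (2^ j) (2^ d) y Δ ⟩
  2^ j * 2^ j * odd w
    ≡⟨ cong (_* odd w) (2^-+ j j) ⟨
  2^ (j ℕ.+ j) * odd w
    ∎)
  where
  w : ℤ
  w = + 2 * y * y + + 2 * y - + 2 * 2^ d * 2^ d * Δ
  regroup : ∀ p q y Δ → p * (+ 2 * y + + 1) * (p * (+ 2 * y + + 1)) - p * (+ 2 * q) * (p * (+ 2 * q)) * Δ
                        ≡ p * p * (+ 2 * (+ 2 * y * y + + 2 * y - + 2 * q * q * Δ) + + 1)
  regroup = solve-∀

sq-sub-∥-scaled : ∀ {s} L W Δ → 2^ s ∥ W * W - Δ →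
                  2^ (L ℕ.+ L ℕ.+ s) ∥ 2^ L * W * (2^ L * W) - 2^ L * 2^ L * Δ
sq-sub-∥-scaled {s} L W Δ (w , e) = w , (begin
  2^ L * W * (2^ L * W) - 2^ L * 2^ L * Δ  ≡⟨ factor (2^ L) W Δ ⟩
  2^ L * 2^ L * (W * W - Δ)                ≡⟨ cong (2^ L * 2^ L *_) e ⟩
  2^ L * 2^ L * (2^ s * odd w)             ≡⟨ ℤₚ.*-assoc (2^ L * 2^ L) (2^ s) (odd w) ⟨
  2^ L * 2^ L * 2^ s * odd w               ≡⟨ cong (_* odd w) 2^[L+L+s]≡ ⟨
  2^ (L ℕ.+ L ℕ.+ s) * odd w               ∎)
  where
  factor : ∀ p W Δ → p * W * (p * W) - p * p * Δ ≡ p * p * (W * W - Δ)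
  factor = solve-∀
  2^[L+L+s]≡ : 2^ (L ℕ.+ L ℕ.+ s) ≡ 2^ L * 2^ L * 2^ s
  2^[L+L+s]≡ = trans (2^-+ (L ℕ.+ L) s) (cong (_* 2^ s) (2^-+ L L))

module Quadratic (α β c : ℤ) (L : ℕ) (Δ : ℤ) (gap : SquareGap Δ)
  (disc : + 2 * β * (+ 2 * β) - + 4 * odd α * c ≡ + (4 ℕ.^ suc L) * Δ) where

  open SquareGap gap

  a : ℤ
  a = odd α

  f : ℕ → ℤ
  f = quad a (+ 2 * β) c

  X : ℕ → ℤ
  X n = a * + n + β

  β²-ac : β * β - a * c ≡ 2^ L * 2^ L * Δ
  β²-ac = ℤₚ.*-cancelˡ-≡ (+ 4) (β * β - a * c) (2^ L * 2^ L * Δ) (begin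
    + 4 * (β * β - a * c)              ≡⟨ regroup β a c ⟩
    + 2 * β * (+ 2 * β) - + 4 * a * c  ≡⟨ disc ⟩
    + (4 ℕ.^ suc L) * Δ                ≡⟨ cong (_* Δ) (ℤₚ.pos-* 4 (4 ℕ.^ L)) ⟩
    + 4 * + (4 ℕ.^ L) * Δ              ≡⟨ cong (λ p → + 4 * p * Δ) (4^≡2^*2^ L) ⟩
    + 4 * (2^ L * 2^ L) * Δ            ≡⟨ ℤₚ.*-assoc (+ 4) (2^ L * 2^ L) Δ ⟩
    + 4 * (2^ L * 2^ L * Δ)            ∎)
    where
    regroup : ∀ β a c → + 4 * (β * β - a * c) ≡ + 2 * β * (+ 2 * β) - + 4 * a * c
    regroup = solve-∀

  completed-square : ∀ n → a * f n ≡ X n * X n - 2^ L * 2^ L * Δ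
  completed-square n = trans (complete a β c (+ n)) (cong (λ d → X n * X n - d) β²-ac)
    where
    complete : ∀ a β c m → a * (a * m * m + + 2 * β * m + c) ≡ (a * m + β) * (a * m + β) - (β * β - a * c)
    complete = solve-∀

  ν₂-f : ∀ {n v Y} → X n ≡ Y → 2^ v ∥ Y * Y - 2^ L * 2^ L * Δ → ν₂ (f n) ≡ just v
  ν₂-f {n} {v} refl h = ν₂-exact (∥-cancel-odd α v (f n) (subst (2^ v ∥_) (sym (completed-square n)) h))

  ν₂-f-below : ∀ {n j} → j < L → 2^ j ∥ X n → ν₂ (f n) ≡ just (j ℕ.+ j)
  ν₂-f-below j<L j∥Xn = ν₂-f refl (sq-sub-∥-below Δ j<L j∥Xn)

  ν₂-f-at : ∀ {n} → 2^ L ∥ X n → ν₂ (f n) ≡ just (L ℕ.+ L ℕ.+ νodd)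
  ν₂-f-at (y , Xn≡) = ν₂-f Xn≡ (sq-sub-∥-scaled L (odd y) Δ (odd²-Δ y))

  ν₂-f-above : ∀ {n z} → X n ≡ 2^ suc L * z → ν₂ (f n) ≡ just (L ℕ.+ L ℕ.+ νeven)
  ν₂-f-above {z = z} Xn≡ = ν₂-f (trans Xn≡ (2^-suc-*ʳ L z)) (sq-sub-∥-scaled L (+ 2 * z) Δ (even²-Δ z))

  ν₂-f-∥ : ∀ {m n j} → j ≤ L → 2^ j ∥ X m → 2^ j ∥ X n → ν₂ (f m) ≡ ν₂ (f n)
  ν₂-f-∥ j≤L j∥Xm j∥Xn with ℕₚ.m≤n⇒m<n∨m≡n j≤L
  ... | inj₁ j<L = trans (ν₂-f-below j<L j∥Xm) (sym (ν₂-f-below j<L j∥Xn))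
  ... | inj₂ refl = trans (ν₂-f-at j∥Xm) (sym (ν₂-f-at j∥Xn))

  ν₂-f-periodic : ∀ m n t → X m ≡ X n + 2^ suc L * t → ν₂ (f m) ≡ ν₂ (f n)
  ν₂-f-periodic m n t Xm≡ with 2^-split (suc L) (X n)
  ... | inj₁ (z , Xn≡) = trans (ν₂-f-above Xm≡') (sym (ν₂-f-above Xn≡))
    where
    Xm≡' : X m ≡ 2^ suc L * (z + t)
    Xm≡' = trans Xm≡ (trans (cong (_+ 2^ suc L * t) Xn≡) (sym (ℤₚ.*-distribˡ-+ (2^ suc L) z t)))
  ... | inj₂ (j , s≤s j≤L , j∥Xn) =
    ν₂-f-∥ j≤L (subst (2^ j ∥_) (sym Xm≡) (∥-+-multiple t (s≤s j≤L) j∥Xn)) j∥Xn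

  ν₂-f-≢-above : ∀ {n k} → k ≤ L → 2^ k ∥ X n → ν₂ (f n) ≢ just (L ℕ.+ L ℕ.+ νeven)
  ν₂-f-≢-above {n} {k} k≤L k∥Xn ν≡ with ℕₚ.m≤n⇒m<n∨m≡n k≤L
  ... | inj₁ k<L = ℕₚ.<⇒≢ k+k<L+L+νeven (just-injective (trans (sym (ν₂-f-below k<L k∥Xn)) ν≡))
    where
    k+k<L+L+νeven : k ℕ.+ k < L ℕ.+ L ℕ.+ νeven
    k+k<L+L+νeven = ℕₚ.<-≤-trans (ℕₚ.+-mono-< k<L k<L) (ℕₚ.m≤m+n (L ℕ.+ L) νeven)
  ... | inj₂ refl =
    νodd≢νeven (ℕₚ.+-cancelˡ-≡ (L ℕ.+ L) νodd νeven (just-injective (trans (sym (ν₂-f-at k∥Xn)) ν≡)))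

  X-shift : ∀ k q r → X (2 ℕ.^ k ℕ.* q ℕ.+ r) ≡ X r + 2^ k * (a * + q)
  X-shift k q r = begin
    a * + (2 ℕ.^ k ℕ.* q ℕ.+ r) + β  ≡⟨ cong (λ m → a * m + β) (trans (ℤₚ.pos-+ (2 ℕ.^ k ℕ.* q) r)
                                                                    (cong (_+ + r) (ℤₚ.pos-* (2 ℕ.^ k) q))) ⟩
    a * (2^ k * + q + + r) + β       ≡⟨ regroup a (2^ k) (+ q) (+ r) β ⟩
    a * + r + β + 2^ k * (a * + q)   ∎
    where
    regroup : ∀ a p q r β → a * (p * q + r) + β ≡ a * r + β + p * (a * q)
    regroup = solve-∀

  X-in-class : ∀ k {r t} → X r ≡ 2^ k * t → ∀ q → X (2 ℕ.^ k ℕ.* q ℕ.+ r) ≡ 2^ k * (a * + q + t)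
  X-in-class k {r} {t} Xr≡ q = begin
    X (2 ℕ.^ k ℕ.* q ℕ.+ r)      ≡⟨ X-shift k q r ⟩
    X r + 2^ k * (a * + q)       ≡⟨ cong (_+ 2^ k * (a * + q)) Xr≡ ⟩
    2^ k * t + 2^ k * (a * + q)  ≡⟨ ℤₚ.*-distribˡ-+ (2^ k) t (a * + q) ⟨
    2^ k * (t + a * + q)         ≡⟨ cong (2^ k *_) (ℤₚ.+-comm t (a * + q)) ⟩
    2^ k * (a * + q + t)         ∎

  divisible-class : ∀ k → ∃[ r ] r < 2 ℕ.^ k × ∃[ t ] X r ≡ 2^ k * t
  divisible-class k with odd-slope-hits-multiple α k β
  ... | n , z , Xn≡ = r , m%n<n n (2 ℕ.^ k) , z - a * + q , (begin
    X r                                          ≡⟨ regroup (X r) (2^ k * (a * + q)) ⟩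
    X r + 2^ k * (a * + q) - 2^ k * (a * + q)    ≡⟨ cong (_- 2^ k * (a * + q)) (X-shift k q r) ⟨
    X (2 ℕ.^ k ℕ.* q ℕ.+ r) - 2^ k * (a * + q)   ≡⟨ cong (λ m → X m - 2^ k * (a * + q)) n≡ ⟨
    X n - 2^ k * (a * + q)                       ≡⟨ cong (_- 2^ k * (a * + q)) Xn≡ ⟩
    2^ k * z - 2^ k * (a * + q)                  ≡⟨ distrib (2^ k) z (a * + q) ⟩
    2^ k * (z - a * + q)                         ∎)
    where
    instance
      2^k≢0 : ℕ.NonZero (2 ℕ.^ k)
      2^k≢0 = ℕₚ.m^n≢0 2 k
    r q : ℕ
    r = n ℕ.% 2 ℕ.^ k
    q = n ℕ./ 2 ℕ.^ k
    n≡ : n ≡ 2 ℕ.^ k ℕ.* q ℕ.+ r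
    n≡ = trans (m≡m%n+[m/n]*n n (2 ℕ.^ k)) (trans (ℕₚ.+-comm r (q ℕ.* 2 ℕ.^ k)) (cong (ℕ._+ r) (ℕₚ.*-comm q (2 ℕ.^ k))))
    regroup : ∀ x y → x ≡ x + y - y
    regroup = solve-∀
    distrib : ∀ p x y → p * x - p * y ≡ p * (x - y)
    distrib = solve-∀

  terminates : AllClassesTerminate f (suc L)
  terminates r _ q = ν₂-f-periodic (2 ℕ.^ suc L ℕ.* q ℕ.+ r) r (a * + q) (X-shift (suc L) q r)

  nonterminating : ∀ k → 1 ≤ k → k < suc L → ¬ AllClassesTerminate f k
  nonterminating k _ (s≤s k≤L) constant with divisible-class k
  ... | r , r<2^k , t , Xr≡ with odd-slope-hits-multiple α (suc L ∸ k) t | odd-slope-hits-odd α t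
  ... | q₁ , z , e₁ | q₂ , u , e₂ = ν₂-f-≢-above k≤L k∥Xn₂ (begin
    ν₂ (f n₂)                      ≡⟨ constant r r<2^k q₂ ⟩
    ν₂ (f r)                       ≡⟨ constant r r<2^k q₁ ⟨
    ν₂ (f n₁)                      ≡⟨ ν₂-f-above Xn₁≡ ⟩
    just (L ℕ.+ L ℕ.+ νeven)       ∎)
    where
    n₁ n₂ : ℕ
    n₁ = 2 ℕ.^ k ℕ.* q₁ ℕ.+ r
    n₂ = 2 ℕ.^ k ℕ.* q₂ ℕ.+ r
    k∥Xn₂ : 2^ k ∥ X n₂
    k∥Xn₂ = u , trans (X-in-class k Xr≡ q₂) (cong (2^ k *_) e₂)
    Xn₁≡ : X n₁ ≡ 2^ suc L * z
    Xn₁≡ = begin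
      X n₁                             ≡⟨ X-in-class k Xr≡ q₁ ⟩
      2^ k * (a * + q₁ + t)            ≡⟨ cong (2^ k *_) e₁ ⟩
      2^ k * (2^ (suc L ∸ k) * z)      ≡⟨ ℤₚ.*-assoc (2^ k) (2^ (suc L ∸ k)) z ⟨
      2^ k * 2^ (suc L ∸ k) * z        ≡⟨ cong (_* z) (2^-+ k (suc L ∸ k)) ⟨
      2^ (k ℕ.+ (suc L ∸ k)) * z       ≡⟨ cong (λ e → 2^ e * z) (ℕₚ.m+[n∸m]≡n (ℕₚ.m≤n⇒m≤1+n k≤L)) ⟩
      2^ suc L * z                     ∎

¬2∣⇒odd : ∀ a → ¬ (+ 2 ∣ a) → ∃[ α ] a ≡ odd α
¬2∣⇒odd a 2∤a with parity a
... | u , inj₁ refl = contradiction (ℤ∣.∣⇒∣ᵤ (ℤ∣.divides u (ℤₚ.*-comm (+ 2) u))) 2∤a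
... | α , inj₂ a≡ = α , a≡

2∣⇒even : ∀ b → + 2 ∣ b → ∃[ β ] b ≡ + 2 * β
2∣⇒even b 2∣b with ℤ∣.∣ᵤ⇒∣ 2∣b
... | ℤ∣.divides β b≡ = β , trans b≡ (ℤₚ.*-comm β (+ 2))

proposition12 : (a b c : ℤ) → ¬ (+ 2 ∣ a) → + 2 ∣ b →
    (ℓ : ℕ) (Δ : ℤ) → 1 ≤ ℓ →
    b ℤ.* b ℤ.- + 4 ℤ.* a ℤ.* c ≡ + (4 ℕ.^ ℓ) ℤ.* Δ →
    (∀ k → 1 ≤ k → + (4 ℕ.^ k) ∣ (b ℤ.* b ℤ.- + 4 ℤ.* a ℤ.* c) → k ≤ ℓ) →
    (Δ %ℕ 8) ∈ (2 ∷ 3 ∷ 5 ∷ 6 ∷ 7 ∷ []) →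
    FiniteTreeWithLevels (quad a b c) ℓ
proposition12 a b c 2∤a 2∣b (suc L) Δ (s≤s z≤n) disc _ Δ%8∈ with ¬2∣⇒odd a 2∤a | 2∣⇒even b 2∣b
... | α , refl | β , refl = s≤s z≤n , terminates , nonterminating
  where
  open Quadratic α β c L Δ (squareGap Δ%8∈) disc
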